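{- Let $n$ and $k$ be positive integers. The equation $(k!)^{n!}-k^n=(n!)^{k!}-n^k$ holds if and only if $k=n$ or $(k,n)\in\{(1,2),(2,1)\}$. -}

module Defs where

-- For k < n the equation reads (k!)^(n!) + n^k = (n!)^(k!) + k^n in ℕ. For k = 1 it says
-- n = n!, which forces n = 2. For 2 ≤ k < n with n ≥ 4 (the pair (2,3) is checked directly)
-- write a = k! and n! = a m with m ≥ n ≥ 4. Then 2m ≤ 2^(m-1) ≤ a^(m-1), so
-- 2 (n!)^a = 2 a^a m^a ≤ a^a (2m)^a ≤ a^(am) = (k!)^(n!), and 2 k^n ≤ a^(n+1) ≤ (k!)^(n!);
-- adding, (n!)^(k!) + k^n ≤ (k!)^(n!) < (k!)^(n!) + n^k.
module Submission where

open import Defs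
open import Data.Nat using (ℕ; _!; _^_; NonZero)
open import Data.Integer using (ℤ; _-_; +_)
open import Data.Product using (_×_)
open import Data.Sum using (_⊎_)
open import Function.Bundles using (_⇔_)
open import Relation.Binary.PropositionalEquality using (_≡_)

open import Data.Nat using (zero; suc; _+_; _*_; _≤_; _<_; _≤′_; ≤′-refl; ≤′-step; z≤n; s≤s)
open import Data.Nat.Properties
open import Data.Nat.Divisibility using (m≤n⇒m!∣n!; quotient; quotient≢0; m∣n⇒n≡m*quotient)
open import Algebra.Properties.CommutativeSemigroup *-commutativeSemigroup
  using (interchange; x∙yz≈y∙xz)
import Data.Integer as ℤ
import Data.Integer.Properties as ℤ
open import Data.Integer.Tactic.RingSolver using (solve-∀)
open import Data.Product using (_,_; ∃-syntax)
open import Data.Sum using (inj₁; inj₂)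
open import Data.Empty using (⊥-elim)
open import Function.Bundles using (mk⇔)
open import Relation.Binary.Definitions using (tri<; tri≈; tri>)
open import Relation.Binary.PropositionalEquality using (refl; sym; trans; cong; cong₂; subst; module ≡-Reasoning)

i-j≡k-l⇒i+l≡k+j : ∀ (i j k l : ℤ) → i - j ≡ k - l → i ℤ.+ l ≡ k ℤ.+ j
i-j≡k-l⇒i+l≡k+j i j k l eq = begin
  i ℤ.+ l                  ≡⟨ regroupˡ i j l ⟩
  (i - j) ℤ.+ (j ℤ.+ l)    ≡⟨ cong (ℤ._+ (j ℤ.+ l)) eq ⟩
  (k - l) ℤ.+ (j ℤ.+ l)    ≡⟨ regroupʳ k j l ⟩
  k ℤ.+ j                  ∎
  where
  open ≡-Reasoning
  regroupˡ : ∀ (i j l : ℤ) → i ℤ.+ l ≡ (i - j) ℤ.+ (j ℤ.+ l)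
  regroupˡ = solve-∀
  regroupʳ : ∀ (k j l : ℤ) → (k - l) ℤ.+ (j ℤ.+ l) ≡ k ℤ.+ j
  regroupʳ = solve-∀

+i-+j≡+k-+l⇒i+l≡k+j : ∀ i j k l → + i - + j ≡ + k - + l → i + l ≡ k + j
+i-+j≡+k-+l⇒i+l≡k+j i j k l eq = ℤ.+-injective (begin
  + (i + l)      ≡⟨ ℤ.pos-+ i l ⟩
  + i ℤ.+ + l    ≡⟨ i-j≡k-l⇒i+l≡k+j (+ i) (+ j) (+ k) (+ l) eq ⟩
  + k ℤ.+ + j    ≡⟨ ℤ.pos-+ k j ⟨
  + (k + j)      ∎)
  where open ≡-Reasoning

2*m≤o⇒2*n≤o⇒m+n≤o : ∀ {m n o} → 2 * m ≤ o → 2 * n ≤ o → m + n ≤ o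
2*m≤o⇒2*n≤o⇒m+n≤o {m} {n} {o} 2m≤o 2n≤o = *-cancelˡ-≤ 2 (begin
  2 * (m + n)      ≡⟨ *-distribˡ-+ 2 m n ⟩
  2 * m + 2 * n    ≤⟨ +-mono-≤ 2m≤o 2n≤o ⟩
  o + o            ≡⟨ cong (_+_ o) (+-identityʳ o) ⟨
  2 * o            ∎)
  where open ≤-Reasoning

^-distribʳ-* : ∀ m n o → (m * n) ^ o ≡ m ^ o * n ^ o
^-distribʳ-* m n zero    = refl
^-distribʳ-* m n (suc o) = begin
  (m * n) * (m * n) ^ o        ≡⟨ cong ((m * n) *_) (^-distribʳ-* m n o) ⟩
  (m * n) * (m ^ o * n ^ o)    ≡⟨ interchange m n (m ^ o) (n ^ o) ⟩
  (m * m ^ o) * (n * n ^ o)    ∎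
  where open ≡-Reasoning

2*[1+p]≤2^p : ∀ {p} → 3 ≤′ p → 2 * suc p ≤ 2 ^ p
2*[1+p]≤2^p ≤′-refl = ≤-refl
2*[1+p]≤2^p {suc p} (≤′-step 3≤p) = begin
  2 * suc (suc p)          ≡⟨ *-suc 2 (suc p) ⟩
  2 + 2 * suc p            ≤⟨ +-monoˡ-≤ (2 * suc p) (m≤m*n 2 (suc p)) ⟩
  2 * suc p + 2 * suc p    ≤⟨ +-mono-≤ ih ih ⟩
  2 ^ p + 2 ^ p            ≡⟨ cong (_+_ (2 ^ p)) (+-identityʳ (2 ^ p)) ⟨
  2 * 2 ^ p                ∎
  where
  open ≤-Reasoning
  ih = 2*[1+p]≤2^p 3≤p

2*[1+p]≤a^p : ∀ {a p} → 2 ≤ a → 3 ≤ p → 2 * suc p ≤ a ^ p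
2*[1+p]≤a^p {a} {p} 2≤a 3≤p = ≤-trans (2*[1+p]≤2^p (≤⇒≤′ 3≤p)) (^-monoˡ-≤ p 2≤a)

2*[a*m]^a≤a^[a*m] : ∀ {a p} → 2 ≤ a → 2 * suc p ≤ a ^ p →
                    2 * (a * suc p) ^ a ≤ a ^ (a * suc p)
2*[a*m]^a≤a^[a*m] {a@(suc _)} {p} 2≤a 2m≤a^p = begin
  2 * (a * m) ^ a              ≡⟨ cong (2 *_) (^-distribʳ-* a m a) ⟩
  2 * (a ^ a * m ^ a)          ≤⟨ *-monoˡ-≤ (a ^ a * m ^ a) (^-monoʳ-≤ 2 {1} {a} (s≤s z≤n)) ⟩
  2 ^ a * (a ^ a * m ^ a)      ≡⟨ x∙yz≈y∙xz (2 ^ a) (a ^ a) (m ^ a) ⟩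
  a ^ a * (2 ^ a * m ^ a)      ≡⟨ cong (a ^ a *_) (^-distribʳ-* 2 m a) ⟨
  a ^ a * (2 * m) ^ a          ≤⟨ *-monoʳ-≤ (a ^ a) (^-monoˡ-≤ a 2m≤a^p) ⟩
  a ^ a * (a ^ p) ^ a          ≡⟨ cong (a ^ a *_) (^-*-assoc a p a) ⟩
  a ^ a * a ^ (p * a)          ≡⟨ ^-distribˡ-+-* a a (p * a) ⟨
  a ^ (a + p * a)              ≡⟨ cong (a ^_) (cong (_+_ a) (*-comm p a)) ⟩
  a ^ (a + a * p)              ≡⟨ cong (a ^_) (*-suc a p) ⟨
  a ^ (a * m)                  ∎
  where
  open ≤-Reasoning
  m = suc p

2*k^n≤a^N : ∀ {k n a N} → 2 ≤ k → k ≤ a → n < N → 2 * k ^ n ≤ a ^ N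
2*k^n≤a^N {k} {n} {a@(suc _)} {N} 2≤k k≤a n<N = begin
  2 * k ^ n    ≤⟨ *-mono-≤ (≤-trans 2≤k k≤a) (^-monoˡ-≤ n k≤a) ⟩
  a ^ suc n    ≤⟨ ^-monoʳ-≤ a n<N ⟩
  a ^ N        ∎
  where open ≤-Reasoning
2*k^n≤a^N {a = zero} (s≤s _) () _

n≤n! : ∀ n → n ≤ n !
n≤n! zero    = z≤n
n≤n! (suc n) = m≤m*n (suc n) (n !) {{n !≢0}}

n<n! : ∀ {n} → 3 ≤ n → n < n !
n<n! {suc n} (s≤s 2≤n) = m<m*n (suc n) (n !) (≤-trans 2≤n (n≤n! n))

m<n⇒n!≡m!*o∧n≤o : ∀ {m n} → m < n → ∃[ o ] n ! ≡ m ! * o × n ≤ o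
m<n⇒n!≡m!*o∧n≤o {m} {suc n} (s≤s m≤n) = suc n * q , n!≡m!*o , m≤m*n (suc n) q
  where
  m!∣n! = m≤n⇒m!∣n! m≤n
  q = quotient m!∣n!
  instance _ = quotient≢0 m!∣n! {{n !≢0}}
  n!≡m!*o : suc n * n ! ≡ m ! * (suc n * q)
  n!≡m!*o = trans (cong (suc n *_) (m∣n⇒n≡m*quotient m!∣n!)) (x∙yz≈y∙xz (suc n) (m !) q)

IsSolution : ℕ → ℕ → Set
IsSolution k n = (k !) ^ (n !) + n ^ k ≡ (n !) ^ (k !) + k ^ n

n!^k!+k^n<k!^n!+n^k : ∀ {k n} → 2 ≤ k → k < n → 4 ≤ n → (n !) ^ (k !) + k ^ n < (k !) ^ (n !) + n ^ k
n!^k!+k^n<k!^n!+n^k {k} {n@(suc _)} 2≤k k<n 4≤n with m<n⇒n!≡m!*o∧n≤o k<n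
... | suc p , n!≡a*m , n≤m = begin-strict
  (n !) ^ a + k ^ n    ≤⟨ 2*m≤o⇒2*n≤o⇒m+n≤o {(n !) ^ a} {k ^ n} 2[n!]^a≤a^n! 2k^n≤a^n! ⟩
  a ^ (n !)            <⟨ m<m+n (a ^ (n !)) (m^n>0 n k) ⟩
  a ^ (n !) + n ^ k    ∎
  where
  open ≤-Reasoning
  a = k !
  2≤a : 2 ≤ a
  2≤a = ≤-trans 2≤k (n≤n! k)
  2[n!]^a≤a^n! : 2 * (n !) ^ a ≤ a ^ (n !)
  2[n!]^a≤a^n! = subst (λ N → 2 * N ^ a ≤ a ^ N) (sym n!≡a*m)
    (2*[a*m]^a≤a^[a*m] 2≤a (2*[1+p]≤a^p 2≤a (≤-pred (≤-trans 4≤n n≤m))))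
  2k^n≤a^n! : 2 * k ^ n ≤ a ^ (n !)
  2k^n≤a^n! = 2*k^n≤a^N 2≤k (n≤n! k) (n<n! (≤-trans (n≤1+n 3) 4≤n))

1-solution : ∀ {n} → IsSolution 1 n → n ≡ n !
1-solution {n} e = suc-injective (begin
  suc n                ≡⟨ cong₂ _+_ (^-zeroˡ (n !)) (^-identityʳ n) ⟨
  1 ^ (n !) + n ^ 1    ≡⟨ e ⟩
  (n !) ^ 1 + 1 ^ n    ≡⟨ cong₂ _+_ (^-identityʳ (n !)) (^-zeroˡ n) ⟩
  n ! + 1              ≡⟨ +-comm (n !) 1 ⟩
  suc (n !)            ∎)
  where open ≡-Reasoning

1<n⇒n≡n!⇒n≡2 : ∀ {n} → 1 < n → n ≡ n ! → n ≡ 2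
1<n⇒n≡n!⇒n≡2 {1}                 (s≤s ()) _
1<n⇒n≡n!⇒n≡2 {2}                 _ _    = refl
1<n⇒n≡n!⇒n≡2 {suc (suc (suc _))} _ n≡n! = ⊥-elim (<-irrefl n≡n! (n<n! (s≤s (s≤s (s≤s z≤n)))))

k<n-solution : ∀ k n .{{_ : NonZero k}} → k < n → IsSolution k n → k ≡ 1 × n ≡ 2
k<n-solution 1 n 1<n e = refl , 1<n⇒n≡n!⇒n≡2 1<n (1-solution e)
k<n-solution 2 1 (s≤s ()) _
k<n-solution 2 2 (s≤s (s≤s ())) _
k<n-solution 2 3 _ ()
k<n-solution 2 n@(suc (suc (suc (suc _)))) 2<n e =
  ⊥-elim (<-irrefl (sym e) (n!^k!+k^n<k!^n!+n^k ≤-refl 2<n (s≤s (s≤s (s≤s (s≤s z≤n))))))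
k<n-solution k@(suc (suc (suc _))) n k<n e =
  ⊥-elim (<-irrefl (sym e) (n!^k!+k^n<k!^n!+n^k (s≤s (s≤s z≤n)) k<n (≤-trans (s≤s 3≤k) k<n)))
  where
  3≤k : 3 ≤ k
  3≤k = s≤s (s≤s (s≤s z≤n))

solution-cases : ∀ k n .{{_ : NonZero k}} .{{_ : NonZero n}} → IsSolution k n →
                 k ≡ n ⊎ ((k ≡ 1 × n ≡ 2) ⊎ (k ≡ 2 × n ≡ 1))
solution-cases k n e with <-cmp k n
... | tri< k<n _ _ = inj₂ (inj₁ (k<n-solution k n k<n e))
... | tri≈ _ k≡n _ = inj₁ k≡n
... | tri> _ _ n<k with n≡1 , k≡2 ← k<n-solution n k n<k (sym e) = inj₂ (inj₂ (k≡2 , n≡1))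

theorem1p1 : (n k : ℕ) → .{{NonZero n}} → .{{NonZero k}} →
    ((+ ((k !) ^ (n !))) - (+ (k ^ n)) ≡ (+ ((n !) ^ (k !))) - (+ (n ^ k)))
      ⇔ (k ≡ n ⊎ ((k ≡ 1 × n ≡ 2) ⊎ (k ≡ 2 × n ≡ 1)))
theorem1p1 n k = mk⇔
  (λ eq → solution-cases k n (+i-+j≡+k-+l⇒i+l≡k+j ((k !) ^ (n !)) (k ^ n) ((n !) ^ (k !)) (n ^ k) eq))
  λ { (inj₁ refl)                 → refl
    ; (inj₂ (inj₁ (refl , refl))) → refl
    ; (inj₂ (inj₂ (refl , refl))) → refl
    }
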